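{- For every integer $n\geq 0$, \[ \sum_{k=0}^{n}(k+1)Q_{n,k} = M_{n+2}-I_{n+2}+(n+2)I_{n+1},\qquad \sum_{k=0}^{n}(n-k+1)Q_{n,k}= I_{n+2}-(n+2)M_{n+1}-M_{n+2}. \]
   Context: An involution of a finite set is a permutation $\sigma$ with $\sigma^2=\mathrm{id}$. For $0\le k\le n$, $Q_{n,k}$ is the number of involutions of $[n+1]=\{1,\dots,n+1\}$ whose largest fixed point is $k+1$. $I_n$ is the number of involutions of $[n]$, and $M_n$ is the number of fixed-point-free involutions of $[n]$. -}

module Defs where

open import Data.Nat using (ℕ; zero; suc)
open import Data.Fin using (Fin; toℕ; _<_)
open import Data.Fin.Properties using (_≟_; _<?_; all?)
open import Data.Vec using (Vec; []; _∷_; lookup)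
open import Data.List using (List; [_]; concatMap; map; allFin; filter; length)
open import Data.Product using (_×_)
open import Data.Integer as ℤ using (ℤ)
open import Relation.Binary.PropositionalEquality using (_≡_; _≢_)
open import Relation.Nullary.Decidable using (Dec; ¬?; _→-dec_; _×-dec_)

-- A self-map of [m] = Fin m is represented by the vector of its values.
-- allMaps m lists every map Fin m → Fin m exactly once.
allVecs : (m n : ℕ) → List (Vec (Fin n) m)
allVecs zero    n = [ [] ]
allVecs (suc m) n = concatMap (λ x → map (x ∷_) (allVecs m n)) (allFin n)

allMaps : (m : ℕ) → List (Vec (Fin m) m)
allMaps m = allVecs m m

-- σ is an involution: σ ∘ σ = id (such a map is automatically a permutation).
IsInvolution : {m : ℕ} → Vec (Fin m) m → Set
IsInvolution σ = ∀ i → lookup σ (lookup σ i) ≡ i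

isInvolution? : {m : ℕ} → (σ : Vec (Fin m) m) → Dec (IsInvolution σ)
isInvolution? σ = all? (λ i → lookup σ (lookup σ i) ≟ i)

IsFixedPointFree : {m : ℕ} → Vec (Fin m) m → Set
IsFixedPointFree σ = ∀ i → lookup σ i ≢ i

isFixedPointFree? : {m : ℕ} → (σ : Vec (Fin m) m) → Dec (IsFixedPointFree σ)
isFixedPointFree? σ = all? (λ i → ¬? (lookup σ i ≟ i))

-- k (0-based index, i.e. the element k+1 of [m]) is the largest fixed point of σ
LargestFixedPoint : {m : ℕ} → Vec (Fin m) m → Fin m → Set
LargestFixedPoint σ k = (lookup σ k ≡ k) × (∀ j → k < j → lookup σ j ≢ j)

largestFixedPoint? : {m : ℕ} → (σ : Vec (Fin m) m) → (k : Fin m) → Dec (LargestFixedPoint σ k)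
largestFixedPoint? σ k =
  (lookup σ k ≟ k) ×-dec all? (λ j → (k <? j) →-dec ¬? (lookup σ j ≟ j))

I : ℕ → ℕ
I n = length (filter isInvolution? (allMaps n))

M : ℕ → ℕ
M n = length (filter (λ σ → isInvolution? σ ×-dec isFixedPointFree? σ) (allMaps n))

-- Q n k (k ∈ {0,…,n}) : number of involutions of [n+1] whose largest fixed point is k+1
Q : (n : ℕ) → Fin (suc n) → ℕ
Q n k = length (filter (λ σ → isInvolution? σ ×-dec largestFixedPoint? σ k) (allMaps (suc n)))

sumFin : (m : ℕ) → (Fin m → ℤ) → ℤ
sumFin zero    f = ℤ.+ 0
sumFin (suc m) f = f Fin.zero ℤ.+ sumFin m (λ k → f (Fin.suc k))

module Submission where

-- Write Q_N(k) for the number of involutions of [N] whose largest fixed point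
-- is k (counted from 0), so that Q_{n,k} = Q_{n+1}(k).  The one
-- combinatorial tool is the decomposition of an involution σ of [m+2] by the
-- image of its top point: either σ fixes it and restricts to an involution of
-- [m+1], or σ exchanges it with some p and restricts to an involution of [m]
-- (module Extension, for any embedding whose image misses two points c, d with
-- σ(c) = d; then invSum-split).  Following fixed points through this
-- decomposition gives I_{m+2} = I_{m+1} + (m+1) I_m, M_{m+2} = (m+1) M_m,
-- Q_{m+2}(top) = I_{m+1} and Q_{m+2}(k) = Σ_{p ≠ k} Q_m(k with p deleted);
-- hence recurrences for S_N = Σ_k (k+1) Q_N(k) and T_N = Σ_k Q_N(k), and by
-- induction  S_N + I_{N+1} = M_{N+1} + (N+1) I_N  and  T_N + M_N = I_N.
-- The second sum equals (n+2) T_{n+1} - S_{n+1}.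

module Counting where
  open import Defs
  open import Data.Nat using (ℕ; zero; suc; _+_; _*_; _∸_)
  open import Data.Nat.Properties
    using (+-*-semiring; +-commutativeSemigroup; +-assoc; +-comm; +-suc; +-identityʳ; *-comm; *-assoc;
           *-identityˡ; *-identityʳ; *-zeroʳ; *-distribˡ-+; *-distribʳ-+; m∸n+n≡m; <⇒≱; ≰⇒>)
  open import Data.Fin using (Fin; toℕ; punchIn; punchOut; fromℕ)
    renaming (zero to fzero; suc to fsuc; _≤_ to _≤ᶠ_; _<_ to _<ᶠ_)
  open import Data.Fin.Properties
    using (punchInᵢ≢i; punchIn-mono-≤; punchIn-cancel-≤; ≤fromℕ; toℕ≤pred[n]; toℕ-fromℕ;
           punchIn-punchOut; punchOut-punchIn; punchOut-cong)
    renaming (_≟_ to _≟ᶠ_; ≤∧≢⇒< to ≤∧≢⇒<ᶠ)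
  open import Data.Vec using (Vec; []; _∷_; lookup; tabulate)
  open import Data.Vec.Properties using (≡-dec; ∷-injective; lookup∘tabulate; tabulate∘lookup; tabulate-cong)
  open import Data.List using (List; []; _∷_; _++_; map; concatMap; allFin; filter; length)
  open import Data.Product using (_×_; _,_; proj₁; proj₂)
  import Data.Integer as ℤ using (ℤ; +_; _+_; _*_)
  import Data.Integer.Properties as ℤ using (pos-+; pos-*)
  open import Data.Maybe using (Maybe; just; nothing; _>>=_)
  open import Data.Maybe.Properties using (just-injective)
  open import Data.Sum using (_⊎_; inj₁; inj₂)
  open import Data.Empty using (⊥-elim)
  open import Function using (_∘_; id)
  open import Relation.Nullary using (Dec; yes; no; ¬_)
  open import Relation.Nullary.Decidable using (_×-dec_)
  open import Relation.Binary.Definitions using (DecidableEquality)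
  open import Relation.Binary.PropositionalEquality
    using (_≡_; _≢_; refl; sym; trans; cong; cong₂; subst; module ≡-Reasoning)
  open import Algebra.Properties.Semiring.Sum +-*-semiring
    using (sum-syntax; sum-cong-≗; sum-remove; ∑-distrib-+; ∑-comm; sum-replicate-zero; *-distribˡ-sum; *-distribʳ-sum)
  open import Algebra.Properties.CommutativeSemigroup +-commutativeSemigroup
    using () renaming (interchange to +-interchange)
  open import Data.Nat.Tactic.RingSolver using (solve-∀)

  open ≡-Reasoning

  sumL : {A : Set} → List A → (A → ℕ) → ℕ
  sumL []       f = 0
  sumL (x ∷ xs) f = f x + sumL xs f

  sumL-cong : {A : Set} (xs : List A) {f g : A → ℕ} → (∀ x → f x ≡ g x) → sumL xs f ≡ sumL xs g
  sumL-cong []       f≗g = refl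
  sumL-cong (x ∷ xs) f≗g = cong₂ _+_ (f≗g x) (sumL-cong xs f≗g)

  sumL-zero : {A : Set} (xs : List A) {f : A → ℕ} → (∀ x → f x ≡ 0) → sumL xs f ≡ 0
  sumL-zero []       f≗0 = refl
  sumL-zero (x ∷ xs) f≗0 = cong₂ _+_ (f≗0 x) (sumL-zero xs f≗0)

  sumL-+ : {A : Set} (xs : List A) (f g : A → ℕ) → sumL xs (λ x → f x + g x) ≡ sumL xs f + sumL xs g
  sumL-+ []       f g = refl
  sumL-+ (x ∷ xs) f g = trans (cong (f x + g x +_) (sumL-+ xs f g)) (+-interchange (f x) (g x) _ _)

  sumL-*ˡ : {A : Set} (xs : List A) (c : ℕ) (f : A → ℕ) → sumL xs (λ x → c * f x) ≡ c * sumL xs f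
  sumL-*ˡ []       c f = sym (*-zeroʳ c)
  sumL-*ˡ (x ∷ xs) c f = trans (cong (c * f x +_) (sumL-*ˡ xs c f)) (sym (*-distribˡ-+ c (f x) _))

  sumL-++ : {A : Set} (xs ys : List A) (f : A → ℕ) → sumL (xs ++ ys) f ≡ sumL xs f + sumL ys f
  sumL-++ []       ys f = refl
  sumL-++ (x ∷ xs) ys f = trans (cong (f x +_) (sumL-++ xs ys f)) (sym (+-assoc (f x) _ _))

  sumL-map : {A B : Set} (g : A → B) (xs : List A) (f : B → ℕ) → sumL (map g xs) f ≡ sumL xs (f ∘ g)
  sumL-map g []       f = refl
  sumL-map g (x ∷ xs) f = cong (f (g x) +_) (sumL-map g xs f)

  sumL-concatMap : {A B : Set} (g : A → List B) (xs : List A) (f : B → ℕ) →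
                   sumL (concatMap g xs) f ≡ sumL xs (λ a → sumL (g a) f)
  sumL-concatMap g []       f = refl
  sumL-concatMap g (x ∷ xs) f =
    trans (sumL-++ (g x) (concatMap g xs) f) (cong (sumL (g x) f +_) (sumL-concatMap g xs f))

  sumL-swap : {A B : Set} (xs : List A) (ys : List B) (h : A → B → ℕ) →
              sumL xs (λ a → sumL ys (h a)) ≡ sumL ys (λ b → sumL xs (λ a → h a b))
  sumL-swap []       ys h = sym (sumL-zero ys (λ _ → refl))
  sumL-swap (x ∷ xs) ys h =
    trans (cong (sumL ys (h x) +_) (sumL-swap xs ys h)) (sym (sumL-+ ys (h x) _))

  ∑-sumL-swap : {B : Set} (n : ℕ) (ys : List B) (h : Fin n → B → ℕ) →
                ∑[ i < n ] sumL ys (h i) ≡ sumL ys (λ b → ∑[ i < n ] h i b)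
  ∑-sumL-swap zero    ys h = sym (sumL-zero ys (λ _ → refl))
  ∑-sumL-swap (suc n) ys h =
    trans (cong (sumL ys (h fzero) +_) (∑-sumL-swap n ys (h ∘ fsuc))) (sym (sumL-+ ys (h fzero) _))

  sumL-allFin : (n : ℕ) (f : Fin n → ℕ) → sumL (allFin n) f ≡ ∑[ i < n ] f i
  sumL-allFin n f = sumL-tabulate n id
    where
    sumL-tabulate : (k : ℕ) (g : Fin k → Fin n) → sumL (Data.List.tabulate g) f ≡ ∑[ i < k ] f (g i)
    sumL-tabulate zero    g = refl
    sumL-tabulate (suc k) g = cong (f (g fzero) +_) (sumL-tabulate k (g ∘ fsuc))

  𝟙 : {P : Set} → Dec P → ℕ
  𝟙 (yes _) = 1
  𝟙 (no _)  = 0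

  𝟙-yes : {P : Set} (d : Dec P) → P → 𝟙 d ≡ 1
  𝟙-yes (yes _) _ = refl
  𝟙-yes (no ¬p) p = ⊥-elim (¬p p)

  𝟙-no : {P : Set} (d : Dec P) → ¬ P → 𝟙 d ≡ 0
  𝟙-no (yes p) ¬p = ⊥-elim (¬p p)
  𝟙-no (no _)  _  = refl

  𝟙-⇔ : {P Q : Set} (d : Dec P) (e : Dec Q) → (P → Q) → (Q → P) → 𝟙 d ≡ 𝟙 e
  𝟙-⇔ (yes _) (yes _) _   _   = refl
  𝟙-⇔ (yes p) (no ¬q) p⇒q _   = ⊥-elim (¬q (p⇒q p))
  𝟙-⇔ (no ¬p) (yes q) _   q⇒p = ⊥-elim (¬p (q⇒p q))
  𝟙-⇔ (no _)  (no _)  _   _   = refl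

  𝟙-× : {P Q : Set} (d : Dec P) (e : Dec Q) → 𝟙 (d ×-dec e) ≡ 𝟙 d * 𝟙 e
  𝟙-× (yes _) (yes _) = refl
  𝟙-× (yes _) (no _)  = refl
  𝟙-× (no _)  (yes _) = refl
  𝟙-× (no _)  (no _)  = refl

  𝟙-yes-* : {P : Set} (d : Dec P) → P → ∀ x → 𝟙 d * x ≡ x
  𝟙-yes-* d p x = trans (cong (_* x) (𝟙-yes d p)) (*-identityˡ x)

  length-filter : {A : Set} {P : A → Set} (P? : ∀ x → Dec (P x)) (xs : List A) →
                  length (filter P? xs) ≡ sumL xs (λ x → 𝟙 (P? x))
  length-filter P? []       = refl
  length-filter P? (x ∷ xs) with P? x
  ... | yes _ = cong suc (length-filter P? xs)
  ... | no _  = length-filter P? xs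

  -- A list enumerating every element of A exactly once.  Sums over such lists
  -- are invariant under bijections, which is how all counting arguments below
  -- compare involutions of different sets.

  EnumeratesOnce : {A : Set} → DecidableEquality A → List A → Set
  EnumeratesOnce {A} _≟_ xs = ∀ (a : A) → sumL xs (λ x → 𝟙 (x ≟ a)) ≡ 1

  sumL-pick : {A : Set} (_≟_ : DecidableEquality A) (xs : List A) → EnumeratesOnce _≟_ xs →
              (a : A) (f : A → ℕ) → sumL xs (λ x → 𝟙 (x ≟ a) * f x) ≡ f a
  sumL-pick _≟_ xs once a f = begin
    sumL xs (λ x → 𝟙 (x ≟ a) * f x) ≡⟨ sumL-cong xs indicator-select ⟩
    sumL xs (λ x → f a * 𝟙 (x ≟ a)) ≡⟨ sumL-*ˡ xs (f a) _ ⟩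
    f a * sumL xs (λ x → 𝟙 (x ≟ a)) ≡⟨ cong (f a *_) (once a) ⟩
    f a * 1                         ≡⟨ *-identityʳ (f a) ⟩
    f a                             ∎
    where
    indicator-select : ∀ x → 𝟙 (x ≟ a) * f x ≡ f a * 𝟙 (x ≟ a)
    indicator-select x with x ≟ a
    ... | yes refl = *-comm 1 (f x)
    ... | no _     = sym (*-zeroʳ (f a))

  sumL-bijection : {A B : Set} (_≟A_ : DecidableEquality A) (_≟B_ : DecidableEquality B)
    (xs : List A) (ys : List B) → EnumeratesOnce _≟A_ xs → EnumeratesOnce _≟B_ ys →
    (f : A → B) (g : B → A) (u : A → ℕ) (v : B → ℕ) →
    (∀ a → u a ≡ 0 ⊎ (g (f a) ≡ a × u a ≡ v (f a))) →
    (∀ b → v b ≡ 0 ⊎ (f (g b) ≡ b × u (g b) ≡ v b)) →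
    sumL xs u ≡ sumL ys v
  sumL-bijection _≟A_ _≟B_ xs ys onceA onceB f g u v forth back = begin
    sumL xs u
      ≡⟨ sumL-cong xs (λ a → sym (sumL-pick _≟B_ ys onceB (f a) (λ _ → u a))) ⟩
    sumL xs (λ a → sumL ys (λ b → 𝟙 (b ≟B f a) * u a)) ≡⟨ sumL-swap xs ys _ ⟩
    sumL ys (λ b → sumL xs (λ a → 𝟙 (b ≟B f a) * u a)) ≡⟨ sumL-cong ys fibre ⟩
    sumL ys v                                         ∎
    where
    fibre : ∀ b → sumL xs (λ a → 𝟙 (b ≟B f a) * u a) ≡ v b
    fibre b with back b
    ... | inj₁ vb≡0 = trans (sumL-zero xs empty) (sym vb≡0)
      where
      empty : ∀ a → 𝟙 (b ≟B f a) * u a ≡ 0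
      empty a with b ≟B f a | forth a
      ... | no _     | _                  = refl
      ... | yes _    | inj₁ ua≡0          = trans (+-identityʳ (u a)) ua≡0
      ... | yes refl | inj₂ (_ , ua≡vfa)  = trans (+-identityʳ (u a)) (trans ua≡vfa vb≡0)
    ... | inj₂ (fgb≡b , ugb≡vb) =
      trans (sumL-cong xs single) (trans (sumL-pick _≟A_ xs onceA (g b) (λ _ → u (g b))) ugb≡vb)
      where
      single : ∀ a → 𝟙 (b ≟B f a) * u a ≡ 𝟙 (a ≟A g b) * u (g b)
      single a with b ≟B f a | a ≟A g b
      ... | yes _     | yes a≡gb = cong (λ z → z + 0) (cong u a≡gb)
      ... | no _      | no _     = refl
      ... | no b≢fa   | yes refl = ⊥-elim (b≢fa (sym fgb≡b))
      ... | yes b≡fa  | no a≢gb  with forth a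
      ...   | inj₁ ua≡0         = trans (+-identityʳ (u a)) ua≡0
      ...   | inj₂ (gfa≡a , _)  = ⊥-elim (a≢gb (trans (sym gfa≡a) (cong g (sym b≡fa))))

  ∑-𝟙-point : (n : ℕ) (a : Fin n) → ∑[ x < n ] 𝟙 (x ≟ᶠ a) ≡ 1
  ∑-𝟙-point (suc n) a = begin
    ∑[ x < suc n ] 𝟙 (x ≟ᶠ a)                  ≡⟨ sum-remove {i = a} (λ x → 𝟙 (x ≟ᶠ a)) ⟩
    𝟙 (a ≟ᶠ a) + ∑[ x < n ] 𝟙 (punchIn a x ≟ᶠ a) ≡⟨ cong₂ _+_ (𝟙-yes (a ≟ᶠ a) refl) off-a ⟩
    1 + 0                                       ∎
    where
    off-a : ∑[ x < n ] 𝟙 (punchIn a x ≟ᶠ a) ≡ 0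
    off-a = trans (sum-cong-≗ (λ x → 𝟙-no (punchIn a x ≟ᶠ a) (punchInᵢ≢i a x))) (sum-replicate-zero n)

  allFin-once : (n : ℕ) → EnumeratesOnce _≟ᶠ_ (allFin n)
  allFin-once n a = trans (sumL-allFin n _) (∑-𝟙-point n a)

  _≟ᵛ_ : {m n : ℕ} → DecidableEquality (Vec (Fin n) m)
  _≟ᵛ_ = ≡-dec _≟ᶠ_

  allVecs-once : (m n : ℕ) → EnumeratesOnce _≟ᵛ_ (allVecs m n)
  allVecs-once zero    n [] = refl
  allVecs-once (suc m) n (y ∷ w) = begin
    sumL (concatMap (λ x → map (x ∷_) (allVecs m n)) (allFin n)) (λ v → 𝟙 (v ≟ᵛ (y ∷ w)))
      ≡⟨ sumL-concatMap _ (allFin n) _ ⟩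
    sumL (allFin n) (λ x → sumL (map (x ∷_) (allVecs m n)) (λ v → 𝟙 (v ≟ᵛ (y ∷ w))))
      ≡⟨ sumL-cong (allFin n) (λ x → sumL-map (x ∷_) (allVecs m n) _) ⟩
    sumL (allFin n) (λ x → sumL (allVecs m n) (λ v → 𝟙 ((x ∷ v) ≟ᵛ (y ∷ w))))
      ≡⟨ sumL-cong (allFin n) (λ x → sumL-cong (allVecs m n) (cons-indicator x)) ⟩
    sumL (allFin n) (λ x → sumL (allVecs m n) (λ v → 𝟙 (x ≟ᶠ y) * 𝟙 (v ≟ᵛ w)))
      ≡⟨ sumL-cong (allFin n) (λ x → trans (sumL-*ˡ (allVecs m n) (𝟙 (x ≟ᶠ y)) _)
                                     (trans (cong (𝟙 (x ≟ᶠ y) *_) (allVecs-once m n w)) (*-identityʳ _))) ⟩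
    sumL (allFin n) (λ x → 𝟙 (x ≟ᶠ y))
      ≡⟨ allFin-once n y ⟩
    1 ∎
    where
    cons-indicator : ∀ x v → 𝟙 ((x ∷ v) ≟ᵛ (y ∷ w)) ≡ 𝟙 (x ≟ᶠ y) * 𝟙 (v ≟ᵛ w)
    cons-indicator x v = trans (𝟙-⇔ ((x ∷ v) ≟ᵛ (y ∷ w)) ((x ≟ᶠ y) ×-dec (v ≟ᵛ w))
                                     ∷-injective (λ { (refl , refl) → refl }))
                               (𝟙-× (x ≟ᶠ y) (v ≟ᵛ w))

  vec-ext : ∀ {k} {A : Set} {u v : Vec A k} → (∀ i → lookup u i ≡ lookup v i) → u ≡ v
  vec-ext {u = u} {v} u≗v = trans (sym (tabulate∘lookup u)) (trans (tabulate-cong u≗v) (tabulate∘lookup v))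

  invSum : (N : ℕ) → (Vec (Fin N) N → ℕ) → ℕ
  invSum N w = sumL (allMaps N) (λ σ → 𝟙 (isInvolution? σ) * w σ)

  -- An embedding of [m] into [N] whose image misses exactly the points c and d
  -- (which may coincide), together with its partial inverse r.
  record Embedding (m N : ℕ) : Set where
    field
      e       : Fin m → Fin N
      r       : Fin N → Maybe (Fin m)
      r-e     : ∀ i → r (e i) ≡ just i
      e-r     : ∀ {x i} → r x ≡ just i → e i ≡ x
      c d     : Fin N
      r-c     : r c ≡ nothing
      r-d     : r d ≡ nothing
      outside : ∀ {x} → r x ≡ nothing → x ≡ c ⊎ x ≡ d

  -- Involutions of [N] with σ(c) = d correspond bijectively to involutions of
  -- [m]: extend τ along e and send c ↦ d, d ↦ c; conversely restrict σ to the
  -- image of e.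
  module Extension {m N : ℕ} (E : Embedding m N) where
    open Embedding E

    e-injective : ∀ {i j} → e i ≡ e j → i ≡ j
    e-injective {i} {j} ei≡ej = just-injective (trans (sym (r-e i)) (trans (cong r ei≡ej) (r-e j)))

    other : Fin N → Fin N
    other x with x ≟ᶠ c
    ... | yes _ = d
    ... | no _  = c

    other-c : other c ≡ d
    other-c with c ≟ᶠ c
    ... | yes _   = refl
    ... | no c≢c  = ⊥-elim (c≢c refl)

    other-d : other d ≡ c
    other-d with d ≟ᶠ c
    ... | yes d≡c = d≡c
    ... | no _    = refl

    other-outside : ∀ {x} → r x ≡ nothing → r (other x) ≡ nothing × other (other x) ≡ x
    other-outside rx with outside rx
    ... | inj₁ refl = subst (λ z → r z ≡ nothing) (sym other-c) r-d , trans (cong other other-c) other-d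
    ... | inj₂ refl = subst (λ z → r z ≡ nothing) (sym other-d) r-c , trans (cong other other-d) other-c

    extendAt : Maybe (Fin m) → Vec (Fin m) m → Fin N → Fin N
    extendAt (just i) τ x = e (lookup τ i)
    extendAt nothing  τ x = other x

    ext : Vec (Fin m) m → Vec (Fin N) N
    ext τ = tabulate (λ x → extendAt (r x) τ x)

    restrictAt : Maybe (Fin m) → Fin m → Fin m
    restrictAt (just j) i = j
    restrictAt nothing  i = i

    res : Vec (Fin N) N → Vec (Fin m) m
    res σ = tabulate (λ i → restrictAt (r (lookup σ (e i))) i)

    ext-e : ∀ τ i → lookup (ext τ) (e i) ≡ e (lookup τ i)
    ext-e τ i = trans (lookup∘tabulate _ (e i)) (cong (λ z → extendAt z τ (e i)) (r-e i))

    ext-outside : ∀ τ {x} → r x ≡ nothing → lookup (ext τ) x ≡ other x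
    ext-outside τ {x} rx = trans (lookup∘tabulate _ x) (cong (λ z → extendAt z τ x) rx)

    ext-c : ∀ τ → lookup (ext τ) c ≡ d
    ext-c τ = trans (ext-outside τ r-c) other-c

    ext-involution : ∀ τ → IsInvolution τ → IsInvolution (ext τ)
    ext-involution τ inv x with r x in rx
    ... | just i = begin
      lookup (ext τ) (lookup (ext τ) x)     ≡⟨ cong (λ z → lookup (ext τ) (lookup (ext τ) z)) (sym (e-r rx)) ⟩
      lookup (ext τ) (lookup (ext τ) (e i)) ≡⟨ cong (lookup (ext τ)) (ext-e τ i) ⟩
      lookup (ext τ) (e (lookup τ i))       ≡⟨ ext-e τ (lookup τ i) ⟩
      e (lookup τ (lookup τ i))             ≡⟨ cong e (inv i) ⟩
      e i                                   ≡⟨ e-r rx ⟩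
      x                                     ∎
    ... | nothing = begin
      lookup (ext τ) (lookup (ext τ) x) ≡⟨ cong (lookup (ext τ)) (ext-outside τ rx) ⟩
      lookup (ext τ) (other x)          ≡⟨ ext-outside τ (proj₁ (other-outside rx)) ⟩
      other (other x)                   ≡⟨ proj₂ (other-outside rx) ⟩
      x                                 ∎

    res-ext : ∀ τ → res (ext τ) ≡ τ
    res-ext τ = vec-ext λ i → begin
      lookup (res (ext τ)) i                ≡⟨ lookup∘tabulate _ i ⟩
      restrictAt (r (lookup (ext τ) (e i))) i ≡⟨ cong (λ z → restrictAt (r z) i) (ext-e τ i) ⟩
      restrictAt (r (e (lookup τ i))) i     ≡⟨ cong (λ z → restrictAt z i) (r-e (lookup τ i)) ⟩
      lookup τ i                            ∎

    -- For an involution σ with σ(c) = d, the image of e is σ-invariant.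
    module _ (σ : Vec (Fin N) N) (inv : IsInvolution σ) (σc≡d : d ≡ lookup σ c) where
      σ-outside : ∀ {x} → r x ≡ nothing → lookup σ x ≡ other x
      σ-outside rx with outside rx
      ... | inj₁ refl = trans (sym σc≡d) (sym other-c)
      ... | inj₂ refl = trans (cong (lookup σ) σc≡d) (trans (inv c) (sym other-d))

      e-res : ∀ i → e (lookup (res σ) i) ≡ lookup σ (e i)
      e-res i with r (lookup σ (e i)) in rx
      ... | just j  = trans (cong e (trans (lookup∘tabulate _ i) (cong (λ z → restrictAt z i) rx))) (e-r rx)
      ... | nothing = ⊥-elim (just≢nothing (begin
        just i                             ≡⟨ r-e i ⟨
        r (e i)                            ≡⟨ cong r (inv (e i)) ⟨
        r (lookup σ (lookup σ (e i)))      ≡⟨ cong r (σ-outside rx) ⟩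
        r (other (lookup σ (e i)))         ≡⟨ proj₁ (other-outside rx) ⟩
        nothing                            ∎))
        where
        just≢nothing : just i ≢ nothing
        just≢nothing ()

      ext-res : ext (res σ) ≡ σ
      ext-res = vec-ext agree
        where
        agree : ∀ x → lookup (ext (res σ)) x ≡ lookup σ x
        agree x with r x in rx
        ... | just i  = begin
          lookup (ext (res σ)) x     ≡⟨ cong (lookup (ext (res σ))) (e-r rx) ⟨
          lookup (ext (res σ)) (e i) ≡⟨ ext-e (res σ) i ⟩
          e (lookup (res σ) i)       ≡⟨ e-res i ⟩
          lookup σ (e i)             ≡⟨ cong (lookup σ) (e-r rx) ⟩
          lookup σ x                 ∎
        ... | nothing = trans (ext-outside (res σ) rx) (sym (σ-outside rx))

      res-involution : IsInvolution (res σ)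
      res-involution i = e-injective (begin
        e (lookup (res σ) (lookup (res σ) i)) ≡⟨ e-res _ ⟩
        lookup σ (e (lookup (res σ) i))       ≡⟨ cong (lookup σ) (e-res i) ⟩
        lookup σ (lookup σ (e i))             ≡⟨ inv (e i) ⟩
        e i                                   ∎)

    decomposition : (w : Vec (Fin N) N → ℕ) →
                    invSum N (λ σ → 𝟙 (d ≟ᶠ lookup σ c) * w σ) ≡ invSum m (w ∘ ext)
    decomposition w = sumL-bijection _≟ᵛ_ _≟ᵛ_ (allMaps N) (allMaps m) (allVecs-once N N) (allVecs-once m m)
                                     res ext u v forth back
      where
      u : Vec (Fin N) N → ℕ
      u σ = 𝟙 (isInvolution? σ) * (𝟙 (d ≟ᶠ lookup σ c) * w σ)
      v : Vec (Fin m) m → ℕ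
      v τ = 𝟙 (isInvolution? τ) * w (ext τ)
      forth : ∀ σ → u σ ≡ 0 ⊎ (ext (res σ) ≡ σ × u σ ≡ v (res σ))
      forth σ with isInvolution? σ | d ≟ᶠ lookup σ c
      ... | no _    | _         = inj₁ refl
      ... | yes _   | no _      = inj₁ refl
      ... | yes inv | yes σc≡d  = inj₂ (ext-res σ inv σc≡d , (begin
        1 * (1 * w σ)                                  ≡⟨ *-identityˡ _ ⟩
        1 * w σ                                        ≡⟨ *-identityˡ _ ⟩
        w σ                                            ≡⟨ cong w (ext-res σ inv σc≡d) ⟨
        w (ext (res σ))                                ≡⟨ 𝟙-yes-* (isInvolution? (res σ)) (res-involution σ inv σc≡d) _ ⟨
        𝟙 (isInvolution? (res σ)) * w (ext (res σ))   ∎))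
      back : ∀ τ → v τ ≡ 0 ⊎ (res (ext τ) ≡ τ × u (ext τ) ≡ v τ)
      back τ with isInvolution? τ
      ... | no _    = inj₁ refl
      ... | yes inv = inj₂ (res-ext τ , (begin
        𝟙 (isInvolution? (ext τ)) * (𝟙 (d ≟ᶠ lookup (ext τ) c) * w (ext τ))
          ≡⟨ 𝟙-yes-* (isInvolution? (ext τ)) (ext-involution τ inv) _ ⟩
        𝟙 (d ≟ᶠ lookup (ext τ) c) * w (ext τ)
          ≡⟨ 𝟙-yes-* (d ≟ᶠ lookup (ext τ) c) (sym (ext-c τ)) _ ⟩
        w (ext τ)
          ≡⟨ *-identityˡ _ ⟨
        1 * w (ext τ) ∎))

    fixed-in-image : ∀ τ {x i} → r x ≡ just i → lookup (ext τ) x ≡ x → lookup τ i ≡ i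
    fixed-in-image τ {x} {i} rx fix = e-injective (begin
      e (lookup τ i)       ≡⟨ ext-e τ i ⟨
      lookup (ext τ) (e i) ≡⟨ cong (lookup (ext τ)) (e-r rx) ⟩
      lookup (ext τ) x     ≡⟨ fix ⟩
      x                    ≡⟨ e-r rx ⟨
      e i                  ∎)

    ext-fixed : ∀ τ {i} → lookup τ i ≡ i → lookup (ext τ) (e i) ≡ e i
    ext-fixed τ {i} fix = trans (ext-e τ i) (cong e fix)

    not-fixed-outside : c ≢ d → ∀ τ {x} → r x ≡ nothing → lookup (ext τ) x ≢ x
    not-fixed-outside c≢d τ rx fix with outside rx
    ... | inj₁ refl = c≢d (trans (sym fix) (ext-c τ))
    ... | inj₂ refl = c≢d (trans (sym (trans (ext-outside τ r-d) other-d)) fix)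

    fixedPointFree-res : ∀ τ → IsFixedPointFree (ext τ) → IsFixedPointFree τ
    fixedPointFree-res τ fpf i fix = fpf (e i) (ext-fixed τ fix)

    fixedPointFree-ext : c ≢ d → ∀ τ → IsFixedPointFree τ → IsFixedPointFree (ext τ)
    fixedPointFree-ext c≢d τ fpf x fix with r x in rx
    ... | just i  = fpf i (fixed-in-image τ rx fix)
    ... | nothing = not-fixed-outside c≢d τ rx fix

    not-fixedPointFree-ext : c ≡ d → ∀ τ → ¬ IsFixedPointFree (ext τ)
    not-fixedPointFree-ext c≡d τ fpf = fpf c (trans (ext-c τ) (sym c≡d))

    not-largest-outside : c ≢ d → ∀ τ {y} → r y ≡ nothing → ¬ LargestFixedPoint (ext τ) y
    not-largest-outside c≢d τ ry (fix , _) = not-fixed-outside c≢d τ ry fix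

    module _ (e-monotone : ∀ {i j} → i ≤ᶠ j → e i ≤ᶠ e j)
             (e-reflects : ∀ {i j} → e i ≤ᶠ e j → i ≤ᶠ j) where
      e-monotone-< : ∀ {i j} → i <ᶠ j → e i <ᶠ e j
      e-monotone-< i<j = ≰⇒> (λ ej≤ei → <⇒≱ i<j (e-reflects ej≤ei))

      e-reflects-< : ∀ {i j} → e i <ᶠ e j → i <ᶠ j
      e-reflects-< ei<ej = ≰⇒> (λ j≤i → <⇒≱ ei<ej (e-monotone j≤i))

      largest-res : ∀ τ {x} → LargestFixedPoint (ext τ) (e x) → LargestFixedPoint τ x
      largest-res τ (fix , above) =
        fixed-in-image τ (r-e _) fix ,
        λ j x<j fixj → above (e j) (e-monotone-< x<j) (ext-fixed τ fixj)

      largest-ext : c ≢ d → ∀ τ {x} → LargestFixedPoint τ x → LargestFixedPoint (ext τ) (e x)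
      largest-ext c≢d τ {x} (fix , above) = ext-fixed τ fix , above-ext
        where
        above-ext : ∀ y → e x <ᶠ y → lookup (ext τ) y ≢ y
        above-ext y ex<y fixy with r y in ry
        ... | just j  = above j (e-reflects-< (subst (e x <ᶠ_) (sym (e-r ry)) ex<y)) (fixed-in-image τ ry fixy)
        ... | nothing = not-fixed-outside c≢d τ ry fixy

  removePoint : {n : ℕ} → Fin (suc n) → Fin (suc n) → Maybe (Fin n)
  removePoint q x with q ≟ᶠ x
  ... | yes _   = nothing
  ... | no q≢x  = just (punchOut q≢x)

  removePoint-punchIn : {n : ℕ} (q : Fin (suc n)) (i : Fin n) → removePoint q (punchIn q i) ≡ just i
  removePoint-punchIn q i with q ≟ᶠ punchIn q i
  ... | yes q≡qi = ⊥-elim (punchInᵢ≢i q i (sym q≡qi))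
  ... | no _     = cong just (trans (punchOut-cong q refl) (punchOut-punchIn q))

  punchIn-removePoint : {n : ℕ} (q : Fin (suc n)) {x : Fin (suc n)} {i : Fin n} →
                        removePoint q x ≡ just i → punchIn q i ≡ x
  punchIn-removePoint q {x} eq with q ≟ᶠ x
  punchIn-removePoint q ()   | yes _
  punchIn-removePoint q refl | no q≢x = punchIn-punchOut q≢x

  removePoint-self : {n : ℕ} (q : Fin (suc n)) → removePoint q q ≡ nothing
  removePoint-self q with q ≟ᶠ q
  ... | yes _  = refl
  ... | no q≢q = ⊥-elim (q≢q refl)

  removePoint-nothing : {n : ℕ} (q : Fin (suc n)) {x : Fin (suc n)} → removePoint q x ≡ nothing → x ≡ q
  removePoint-nothing q {x} eq with q ≟ᶠ x
  removePoint-nothing q eq | yes q≡x = sym q≡x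
  removePoint-nothing q () | no _

  top : (m : ℕ) → Fin (suc m)
  top m = fromℕ m

  -- [m] inside [m+1], missing only the top point: σ(top) = top.
  fixTop : (m : ℕ) → Embedding m (suc m)
  fixTop m = record
    { e       = punchIn (top m)
    ; r       = removePoint (top m)
    ; r-e     = removePoint-punchIn (top m)
    ; e-r     = punchIn-removePoint (top m)
    ; c       = top m
    ; d       = top m
    ; r-c     = removePoint-self (top m)
    ; r-d     = removePoint-self (top m)
    ; outside = λ rx → inj₁ (removePoint-nothing (top m) rx)
    }

  -- [m] inside [m+2], missing the top point and the point p below it:
  -- σ(top) = p.
  swapTop : (m : ℕ) (p : Fin (suc m)) → Embedding m (suc (suc m))
  swapTop m p = record
    { e       = punchIn t ∘ punchIn p
    ; r       = r
    ; r-e     = λ i → trans (cong (_>>= removePoint p) (removePoint-punchIn t (punchIn p i))) (removePoint-punchIn p i)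
    ; e-r     = e-r
    ; c       = t
    ; d       = punchIn t p
    ; r-c     = cong (_>>= removePoint p) (removePoint-self t)
    ; r-d     = trans (cong (_>>= removePoint p) (removePoint-punchIn t p)) (removePoint-self p)
    ; outside = outside
    }
    where
    t : Fin (suc (suc m))
    t = top (suc m)
    r : Fin (suc (suc m)) → Maybe (Fin m)
    r x = removePoint t x >>= removePoint p
    e-r : ∀ {x i} → r x ≡ just i → punchIn t (punchIn p i) ≡ x
    e-r {x} rx with removePoint t x in eq
    ... | just y = trans (cong (punchIn t) (punchIn-removePoint p rx)) (punchIn-removePoint t eq)
    outside : ∀ {x} → r x ≡ nothing → x ≡ t ⊎ x ≡ punchIn t p
    outside {x} rx with removePoint t x in eq
    ... | nothing = inj₁ (removePoint-nothing t eq)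
    ... | just y  = inj₂ (trans (sym (punchIn-removePoint t eq)) (cong (punchIn t) (removePoint-nothing p rx)))

  extFix : (m : ℕ) → Vec (Fin (suc m)) (suc m) → Vec (Fin (suc (suc m))) (suc (suc m))
  extFix m = Extension.ext (fixTop (suc m))

  extSwap : (m : ℕ) → Fin (suc m) → Vec (Fin m) m → Vec (Fin (suc (suc m))) (suc (suc m))
  extSwap m p = Extension.ext (swapTop m p)

  invSum-split : (m : ℕ) (w : Vec (Fin (suc (suc m))) (suc (suc m)) → ℕ) →
    invSum (suc (suc m)) w ≡ invSum (suc m) (w ∘ extFix m) + ∑[ p < suc m ] invSum m (w ∘ extSwap m p)
  invSum-split m w = begin
    invSum (suc (suc m)) w
      ≡⟨ sumL-cong maps split-weight ⟩
    sumL maps (λ σ → onTop σ + ∑[ p < suc m ] onP p σ)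
      ≡⟨ sumL-+ maps onTop _ ⟩
    sumL maps onTop + sumL maps (λ σ → ∑[ p < suc m ] onP p σ)
      ≡⟨ cong (sumL maps onTop +_) (∑-sumL-swap (suc m) maps onP) ⟨
    sumL maps onTop + ∑[ p < suc m ] sumL maps (onP p)
      ≡⟨ cong₂ _+_ (Extension.decomposition (fixTop (suc m)) w)
                   (sum-cong-≗ (λ p → Extension.decomposition (swapTop m p) w)) ⟩
    invSum (suc m) (w ∘ extFix m) + ∑[ p < suc m ] invSum m (w ∘ extSwap m p) ∎
    where
    t = top (suc m)
    maps = allMaps (suc (suc m))
    onTop : Vec (Fin (suc (suc m))) (suc (suc m)) → ℕ
    onTop σ = 𝟙 (isInvolution? σ) * (𝟙 (t ≟ᶠ lookup σ t) * w σ)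
    onP : Fin (suc m) → Vec (Fin (suc (suc m))) (suc (suc m)) → ℕ
    onP p σ = 𝟙 (isInvolution? σ) * (𝟙 (punchIn t p ≟ᶠ lookup σ t) * w σ)
    one-split : ∀ y → 1 ≡ 𝟙 (t ≟ᶠ y) + ∑[ p < suc m ] 𝟙 (punchIn t p ≟ᶠ y)
    one-split y = trans (sym (∑-𝟙-point _ y)) (sum-remove {i = t} (λ x → 𝟙 (x ≟ᶠ y)))
    split-weight : ∀ σ → 𝟙 (isInvolution? σ) * w σ ≡ onTop σ + ∑[ p < suc m ] onP p σ
    split-weight σ = begin
      a * w σ                                        ≡⟨ cong (a *_) (*-identityˡ (w σ)) ⟨
      a * (1 * w σ)                                  ≡⟨ cong (λ z → a * (z * w σ)) (one-split y) ⟩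
      a * ((X + ∑[ p < suc m ] Y p) * w σ)           ≡⟨ cong (a *_) (*-distribʳ-+ (w σ) X _) ⟩
      a * (X * w σ + (∑[ p < suc m ] Y p) * w σ)     ≡⟨ *-distribˡ-+ a (X * w σ) _ ⟩
      a * (X * w σ) + a * ((∑[ p < suc m ] Y p) * w σ)
        ≡⟨ cong (λ z → a * (X * w σ) + a * z) (*-distribʳ-sum (w σ) Y) ⟩
      a * (X * w σ) + a * (∑[ p < suc m ] (Y p * w σ))
        ≡⟨ cong (a * (X * w σ) +_) (*-distribˡ-sum a (λ p → Y p * w σ)) ⟩
      a * (X * w σ) + ∑[ p < suc m ] (a * (Y p * w σ)) ∎
      where
      y = lookup σ t
      a = 𝟙 (isInvolution? σ)
      X = 𝟙 (t ≟ᶠ y)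
      Y : Fin (suc m) → ℕ
      Y p = 𝟙 (punchIn t p ≟ᶠ y)

  invSum-cong : (N : ℕ) {w w′ : Vec (Fin N) N → ℕ} → (∀ σ → w σ ≡ w′ σ) → invSum N w ≡ invSum N w′
  invSum-cong N w≗w′ = sumL-cong (allMaps N) (λ σ → cong (𝟙 (isInvolution? σ) *_) (w≗w′ σ))

  invSum-zero : (N : ℕ) {w : Vec (Fin N) N → ℕ} → (∀ σ → w σ ≡ 0) → invSum N w ≡ 0
  invSum-zero N w≗0 =
    sumL-zero (allMaps N) (λ σ → trans (cong (𝟙 (isInvolution? σ) *_) (w≗0 σ)) (*-zeroʳ (𝟙 (isInvolution? σ))))

  ∑-const : (n c : ℕ) → ∑[ i < n ] c ≡ n * c
  ∑-const zero    c = refl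
  ∑-const (suc n) c = cong (c +_) (∑-const n c)

  invCount : ℕ → ℕ
  invCount N = invSum N (λ _ → 1)

  fpfCount : ℕ → ℕ
  fpfCount N = invSum N (λ σ → 𝟙 (isFixedPointFree? σ))

  lfpCount : (N : ℕ) → Fin N → ℕ
  lfpCount N k = invSum N (λ σ → 𝟙 (largestFixedPoint? σ k))

  count-involutions-with : (N : ℕ) {P : Vec (Fin N) N → Set} (P? : ∀ σ → Dec (P σ)) →
    length (filter (λ σ → isInvolution? σ ×-dec P? σ) (allMaps N)) ≡ invSum N (λ σ → 𝟙 (P? σ))
  count-involutions-with N P? = trans (length-filter _ (allMaps N))
                                      (sumL-cong (allMaps N) (λ σ → 𝟙-× (isInvolution? σ) (P? σ)))

  I≡invCount : (N : ℕ) → I N ≡ invCount N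
  I≡invCount N = trans (length-filter isInvolution? (allMaps N))
                       (sumL-cong (allMaps N) (λ σ → sym (*-identityʳ (𝟙 (isInvolution? σ)))))

  M≡fpfCount : (N : ℕ) → M N ≡ fpfCount N
  M≡fpfCount N = count-involutions-with N isFixedPointFree?

  Q≡lfpCount : (n : ℕ) (k : Fin (suc n)) → Q n k ≡ lfpCount (suc n) k
  Q≡lfpCount n k = count-involutions-with (suc n) (λ σ → largestFixedPoint? σ k)

  I-rec : (m : ℕ) → I (suc (suc m)) ≡ I (suc m) + suc m * I m
  I-rec m = begin
    I (suc (suc m))
      ≡⟨ I≡invCount (suc (suc m)) ⟩
    invCount (suc (suc m))
      ≡⟨ invSum-split m (λ _ → 1) ⟩
    invCount (suc m) + ∑[ p < suc m ] invCount m
      ≡⟨ cong (invCount (suc m) +_) (∑-const (suc m) (invCount m)) ⟩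
    invCount (suc m) + suc m * invCount m
      ≡⟨ cong₂ (λ x y → x + suc m * y) (I≡invCount (suc m)) (I≡invCount m) ⟨
    I (suc m) + suc m * I m ∎

  top≢punchIn-top : (m : ℕ) (p : Fin (suc m)) → top (suc m) ≢ punchIn (top (suc m)) p
  top≢punchIn-top m p t≡p′ = punchInᵢ≢i (top (suc m)) p (sym t≡p′)

  -- M_{m+2} = (m+1) M_m: an involution fixing the top point is not fixed-point-free.
  M-rec : (m : ℕ) → M (suc (suc m)) ≡ suc m * M m
  M-rec m = begin
    M (suc (suc m))
      ≡⟨ M≡fpfCount (suc (suc m)) ⟩
    fpfCount (suc (suc m))
      ≡⟨ invSum-split m (λ σ → 𝟙 (isFixedPointFree? σ)) ⟩
    invSum (suc m) (λ τ → 𝟙 (isFixedPointFree? (extFix m τ)))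
      + ∑[ p < suc m ] invSum m (λ τ → 𝟙 (isFixedPointFree? (extSwap m p τ)))
      ≡⟨ cong₂ _+_ (invSum-zero (suc m) fixTop-none) (sum-cong-≗ (λ p → invSum-cong m (swapTop-same p))) ⟩
    ∑[ p < suc m ] fpfCount m
      ≡⟨ ∑-const (suc m) (fpfCount m) ⟩
    suc m * fpfCount m
      ≡⟨ cong (suc m *_) (M≡fpfCount m) ⟨
    suc m * M m ∎
    where
    fixTop-none : ∀ τ → 𝟙 (isFixedPointFree? (extFix m τ)) ≡ 0
    fixTop-none τ = 𝟙-no (isFixedPointFree? (extFix m τ)) (Extension.not-fixedPointFree-ext (fixTop (suc m)) refl τ)
    swapTop-same : ∀ p τ → 𝟙 (isFixedPointFree? (extSwap m p τ)) ≡ 𝟙 (isFixedPointFree? τ)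
    swapTop-same p τ = 𝟙-⇔ (isFixedPointFree? (extSwap m p τ)) (isFixedPointFree? τ)
      (Extension.fixedPointFree-res (swapTop m p) τ)
      (Extension.fixedPointFree-ext (swapTop m p) (top≢punchIn-top m p) τ)

  top-largest : (m : ℕ) (τ : Vec (Fin (suc m)) (suc m)) → LargestFixedPoint (extFix m τ) (top (suc m))
  top-largest m τ = Extension.ext-c (fixTop (suc m)) τ , λ j t<j _ → <⇒≱ t<j (≤fromℕ j)

  only-top-largest : (m : ℕ) (τ : Vec (Fin (suc m)) (suc m)) {k : Fin (suc (suc m))} →
                     k ≢ top (suc m) → ¬ LargestFixedPoint (extFix m τ) k
  only-top-largest m τ {k} k≢t (_ , above) =
    above (top (suc m)) (≤∧≢⇒<ᶠ (≤fromℕ k) k≢t) (Extension.ext-c (fixTop (suc m)) τ)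

  -- Involutions of [m+2] exchanging top and p.  Their embedding
  -- punchIn top ∘ punchIn p is monotone and reflects the order, so largest
  -- fixed points below top are those of the restriction.
  module SwapTop (m : ℕ) (p : Fin (suc m)) where
    open Extension (swapTop m p) public

    monotone : ∀ {i j} → i ≤ᶠ j → punchIn (top (suc m)) (punchIn p i) ≤ᶠ punchIn (top (suc m)) (punchIn p j)
    monotone i≤j = punchIn-mono-≤ (top (suc m)) _ _ (punchIn-mono-≤ p _ _ i≤j)

    reflects : ∀ {i j} → punchIn (top (suc m)) (punchIn p i) ≤ᶠ punchIn (top (suc m)) (punchIn p j) → i ≤ᶠ j
    reflects ei≤ej = punchIn-cancel-≤ p _ _ (punchIn-cancel-≤ (top (suc m)) _ _ ei≤ej)

    lfpSwap : Fin (suc m) → ℕ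
    lfpSwap k = invSum m (λ τ → 𝟙 (largestFixedPoint? (ext τ) (punchIn (top (suc m)) k)))

    -- p itself is moved, so it is never the largest fixed point ...
    lfpSwap-p : lfpSwap p ≡ 0
    lfpSwap-p = invSum-zero m (λ τ → 𝟙-no (largestFixedPoint? (ext τ) _)
                                         (not-largest-outside (top≢punchIn-top m p) τ r-d))
      where open Embedding (swapTop m p) using (r-d)

    lfpSwap-punchIn : ∀ x → lfpSwap (punchIn p x) ≡ lfpCount m x
    lfpSwap-punchIn x = invSum-cong m (λ τ → 𝟙-⇔ (largestFixedPoint? (ext τ) _) (largestFixedPoint? τ x)
      (largest-res monotone reflects τ)
      (largest-ext monotone reflects (top≢punchIn-top m p) τ))

  lfpCount-top : (m : ℕ) → lfpCount (suc (suc m)) (top (suc m)) ≡ I (suc m)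
  lfpCount-top m = begin
    lfpCount (suc (suc m)) t
      ≡⟨ invSum-split m (λ σ → 𝟙 (largestFixedPoint? σ t)) ⟩
    invSum (suc m) (λ τ → 𝟙 (largestFixedPoint? (extFix m τ) t))
      + ∑[ p < suc m ] invSum m (λ τ → 𝟙 (largestFixedPoint? (extSwap m p τ) t))
      ≡⟨ cong₂ _+_ (invSum-cong (suc m) (λ τ → 𝟙-yes (largestFixedPoint? (extFix m τ) t) (top-largest m τ)))
                   (sum-cong-≗ (λ p → invSum-zero m (top-not-largest p))) ⟩
    invCount (suc m) + ∑[ p < suc m ] 0
      ≡⟨ cong (invCount (suc m) +_) (trans (∑-const (suc m) 0) (*-zeroʳ m)) ⟩
    invCount (suc m) + 0
      ≡⟨ +-identityʳ _ ⟩
    invCount (suc m)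
      ≡⟨ I≡invCount (suc m) ⟨
    I (suc m) ∎
    where
    t = top (suc m)
    top-not-largest : ∀ p τ → 𝟙 (largestFixedPoint? (extSwap m p τ) t) ≡ 0
    top-not-largest p τ = 𝟙-no (largestFixedPoint? (extSwap m p τ) t)
      (SwapTop.not-largest-outside m p (top≢punchIn-top m p) τ (Embedding.r-c (swapTop m p)))

  -- Q_{m+2}(k) for k below top: the top point is exchanged with some p.
  lfpCount-below : (m : ℕ) (k : Fin (suc m)) →
                   lfpCount (suc (suc m)) (punchIn (top (suc m)) k) ≡ ∑[ p < suc m ] SwapTop.lfpSwap m p k
  lfpCount-below m k = trans (invSum-split m (λ σ → 𝟙 (largestFixedPoint? σ k′)))
    (cong (_+ ∑[ p < suc m ] SwapTop.lfpSwap m p k)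
          (invSum-zero (suc m) (λ τ → 𝟙-no (largestFixedPoint? (extFix m τ) k′)
                                             (only-top-largest m τ (punchInᵢ≢i (top (suc m)) k)))))
    where k′ = punchIn (top (suc m)) k

  moment : (N : ℕ) → (ℕ → ℕ) → ℕ
  moment N c = ∑[ k < N ] (c (toℕ k) * lfpCount N k)

  toℕ-punchIn-top : (n : ℕ) (j : Fin n) → toℕ (punchIn (top n) j) ≡ toℕ j
  toℕ-punchIn-top (suc n) fzero    = refl
  toℕ-punchIn-top (suc n) (fsuc j) = cong suc (toℕ-punchIn-top n j)

  ∑-lfpSwap : (m : ℕ) (c : ℕ → ℕ) →
    ∑[ k < suc m ] (c (toℕ k) * ∑[ p < suc m ] SwapTop.lfpSwap m p k)
      ≡ ∑[ x < m ] ((∑[ p < suc m ] c (toℕ (punchIn p x))) * lfpCount m x)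
  ∑-lfpSwap m c = begin
    ∑[ k < suc m ] (c (toℕ k) * ∑[ p < suc m ] lfpSwap p k)
      ≡⟨ sum-cong-≗ (λ k → *-distribˡ-sum (c (toℕ k)) (λ p → lfpSwap p k)) ⟩
    ∑[ k < suc m ] ∑[ p < suc m ] (c (toℕ k) * lfpSwap p k)
      ≡⟨ ∑-comm (λ k p → c (toℕ k) * lfpSwap p k) ⟩
    ∑[ p < suc m ] ∑[ k < suc m ] (c (toℕ k) * lfpSwap p k)
      ≡⟨ sum-cong-≗ (λ p → sum-remove {i = p} (λ k → c (toℕ k) * lfpSwap p k)) ⟩
    ∑[ p < suc m ] (c (toℕ p) * lfpSwap p p + ∑[ x < m ] (c (toℕ (punchIn p x)) * lfpSwap p (punchIn p x)))
      ≡⟨ sum-cong-≗ (λ p → cong₂ _+_ (trans (cong (c (toℕ p) *_) (SwapTop.lfpSwap-p m p)) (*-zeroʳ (c (toℕ p))))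
                                     (sum-cong-≗ (λ x → cong (c (toℕ (punchIn p x)) *_)
                                                             (SwapTop.lfpSwap-punchIn m p x)))) ⟩
    ∑[ p < suc m ] ∑[ x < m ] (c (toℕ (punchIn p x)) * lfpCount m x)
      ≡⟨ ∑-comm (λ p x → c (toℕ (punchIn p x)) * lfpCount m x) ⟩
    ∑[ x < m ] ∑[ p < suc m ] (c (toℕ (punchIn p x)) * lfpCount m x)
      ≡⟨ sum-cong-≗ (λ x → *-distribʳ-sum (lfpCount m x) (λ p → c (toℕ (punchIn p x)))) ⟨
    ∑[ x < m ] ((∑[ p < suc m ] c (toℕ (punchIn p x))) * lfpCount m x) ∎
    where
    lfpSwap : Fin (suc m) → Fin (suc m) → ℕ
    lfpSwap = SwapTop.lfpSwap m

  moment-rec : (m : ℕ) (c : ℕ → ℕ) →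
    moment (suc (suc m)) c
      ≡ c (suc m) * I (suc m) + ∑[ x < m ] ((∑[ p < suc m ] c (toℕ (punchIn p x))) * lfpCount m x)
  moment-rec m c = begin
    moment (suc (suc m)) c
      ≡⟨ sum-remove {i = t} (λ k → c (toℕ k) * lfpCount (suc (suc m)) k) ⟩
    c (toℕ t) * lfpCount (suc (suc m)) t
      + ∑[ k < suc m ] (c (toℕ (punchIn t k)) * lfpCount (suc (suc m)) (punchIn t k))
      ≡⟨ cong₂ _+_ (cong₂ _*_ (cong c (toℕ-fromℕ (suc m))) (lfpCount-top m))
                   (sum-cong-≗ (λ k → cong₂ _*_ (cong c (toℕ-punchIn-top (suc m) k)) (lfpCount-below m k))) ⟩
    c (suc m) * I (suc m) + ∑[ k < suc m ] (c (toℕ k) * ∑[ p < suc m ] SwapTop.lfpSwap m p k)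
      ≡⟨ cong (c (suc m) * I (suc m) +_) (∑-lfpSwap m c) ⟩
    c (suc m) * I (suc m) + ∑[ x < m ] ((∑[ p < suc m ] c (toℕ (punchIn p x))) * lfpCount m x) ∎
    where t = top (suc m)

  -- Σ_{p ≤ m} (1 + punchIn p x) = (m+2)(x+1): the value x is shifted up by one
  -- exactly for the x+1 partners p ≤ x.
  ∑-rank-punchIn : (m : ℕ) (x : Fin m) → ∑[ p < suc m ] suc (toℕ (punchIn p x)) ≡ suc (suc m) * suc (toℕ x)
  ∑-rank-punchIn (suc m) fzero = begin
    2 + ∑[ p < suc m ] 1 ≡⟨ cong (2 +_) (∑-const (suc m) 1) ⟩
    2 + suc m * 1        ≡⟨ cong (2 +_) (*-identityʳ (suc m)) ⟩
    suc (suc (suc m))     ≡⟨ *-identityʳ _ ⟨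
    suc (suc (suc m)) * 1 ∎
  ∑-rank-punchIn (suc m) (fsuc x) = begin
    3 + toℕ x + ∑[ p < suc m ] (1 + suc (toℕ (punchIn p x)))
      ≡⟨ cong (3 + toℕ x +_) (∑-distrib-+ (λ _ → 1) (λ p → suc (toℕ (punchIn p x)))) ⟩
    3 + toℕ x + (∑[ p < suc m ] 1 + ∑[ p < suc m ] suc (toℕ (punchIn p x)))
      ≡⟨ cong (λ z → 3 + toℕ x + z) (cong₂ _+_ (∑-const (suc m) 1) (∑-rank-punchIn m x)) ⟩
    3 + toℕ x + (suc m * 1 + suc (suc m) * suc (toℕ x))
      ≡⟨ arithmetic m (toℕ x) ⟩
    suc (suc (suc m)) * suc (suc (toℕ x)) ∎
    where
    arithmetic : ∀ m x → 3 + x + (suc m * 1 + suc (suc m) * suc x) ≡ suc (suc (suc m)) * suc (suc x)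
    arithmetic = solve-∀

  -- S_N = Σ_k (k+1) Q_N(k)  and  T_N = Σ_k Q_N(k)  (k counted from 0).
  rankSum : ℕ → ℕ
  rankSum N = moment N suc

  lfpTotal : ℕ → ℕ
  lfpTotal N = moment N (λ _ → 1)

  rankSum-rec : (m : ℕ) → rankSum (suc (suc m)) ≡ suc (suc m) * (I (suc m) + rankSum m)
  rankSum-rec m = begin
    rankSum (suc (suc m))
      ≡⟨ moment-rec m suc ⟩
    k * I (suc m) + ∑[ x < m ] ((∑[ p < suc m ] suc (toℕ (punchIn p x))) * lfpCount m x)
      ≡⟨ cong (k * I (suc m) +_) (sum-cong-≗ (λ x → trans (cong (_* lfpCount m x) (∑-rank-punchIn m x))
                                                                 (*-assoc k (suc (toℕ x)) (lfpCount m x)))) ⟩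
    k * I (suc m) + ∑[ x < m ] (k * (suc (toℕ x) * lfpCount m x))
      ≡⟨ cong (k * I (suc m) +_) (*-distribˡ-sum k (λ x → suc (toℕ x) * lfpCount m x)) ⟨
    k * I (suc m) + k * rankSum m
      ≡⟨ *-distribˡ-+ k (I (suc m)) (rankSum m) ⟨
    k * (I (suc m) + rankSum m) ∎
    where k = suc (suc m)

  lfpTotal-rec : (m : ℕ) → lfpTotal (suc (suc m)) ≡ I (suc m) + suc m * lfpTotal m
  lfpTotal-rec m = begin
    lfpTotal (suc (suc m))
      ≡⟨ moment-rec m (λ _ → 1) ⟩
    1 * I (suc m) + ∑[ x < m ] ((∑[ p < suc m ] 1) * lfpCount m x)
      ≡⟨ cong₂ _+_ (*-identityˡ (I (suc m)))
                   (sum-cong-≗ (λ x → trans (cong (_* lfpCount m x) (∑-const (suc m) 1))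
                                            (*-assoc (suc m) 1 (lfpCount m x)))) ⟩
    I (suc m) + ∑[ x < m ] (suc m * (1 * lfpCount m x))
      ≡⟨ cong (I (suc m) +_) (*-distribˡ-sum (suc m) (λ x → 1 * lfpCount m x)) ⟨
    I (suc m) + suc m * lfpTotal m ∎

  -- T_N + M_N = I_N: an involution is fixed-point-free or has a largest
  -- fixed point.  By induction from the recurrences.
  lfpTotal-closed : (N : ℕ) → lfpTotal N + M N ≡ I N
  lfpTotal-closed zero          = refl
  lfpTotal-closed (suc zero)    = refl
  lfpTotal-closed (suc (suc m)) = begin
    lfpTotal (2 + m) + M (2 + m)
      ≡⟨ cong₂ _+_ (lfpTotal-rec m) (M-rec m) ⟩
    I (1 + m) + (1 + m) * lfpTotal m + (1 + m) * M m
      ≡⟨ +-assoc (I (1 + m)) _ _ ⟩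
    I (1 + m) + ((1 + m) * lfpTotal m + (1 + m) * M m)
      ≡⟨ cong (I (1 + m) +_) (*-distribˡ-+ (1 + m) (lfpTotal m) (M m)) ⟨
    I (1 + m) + (1 + m) * (lfpTotal m + M m)
      ≡⟨ cong (λ z → I (1 + m) + (1 + m) * z) (lfpTotal-closed m) ⟩
    I (1 + m) + (1 + m) * I m
      ≡⟨ I-rec m ⟨
    I (2 + m) ∎

  rankSum-closed : (N : ℕ) → rankSum N + I (suc N) ≡ M (suc N) + suc N * I N
  rankSum-closed zero          = refl
  rankSum-closed (suc zero)    = refl
  rankSum-closed (suc (suc m)) = begin
    rankSum (2 + m) + I (3 + m)
      ≡⟨ cong₂ _+_ (rankSum-rec m) (I-rec (suc m)) ⟩
    (2 + m) * (a + S) + (e + (2 + m) * a)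
      ≡⟨ regroup m a S e ⟩
    (2 + m) * (S + a) + (2 + m) * a + e
      ≡⟨ cong (λ z → (2 + m) * z + (2 + m) * a + e) (rankSum-closed m) ⟩
    (2 + m) * (d + (1 + m) * b) + (2 + m) * a + e
      ≡⟨ regroup′ m a b d e ⟩
    (2 + m) * d + (2 + m) * (a + (1 + m) * b) + e
      ≡⟨ cong (λ z → (2 + m) * d + (2 + m) * z + e) (I-rec m) ⟨
    (2 + m) * d + (2 + m) * e + e
      ≡⟨ collect m d e ⟩
    (2 + m) * d + (3 + m) * e
      ≡⟨ cong (_+ (3 + m) * e) (M-rec (suc m)) ⟨
    M (3 + m) + (3 + m) * I (2 + m) ∎
    where
    S = rankSum m
    a = I (1 + m)
    b = I m
    d = M (1 + m)
    e = I (2 + m)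
    regroup : ∀ m a S e → (2 + m) * (a + S) + (e + (2 + m) * a) ≡ (2 + m) * (S + a) + (2 + m) * a + e
    regroup = solve-∀
    regroup′ : ∀ m a b d e →
      (2 + m) * (d + (1 + m) * b) + (2 + m) * a + e ≡ (2 + m) * d + (2 + m) * (a + (1 + m) * b) + e
    regroup′ = solve-∀
    collect : ∀ m d e → (2 + m) * d + (2 + m) * e + e ≡ (2 + m) * d + (3 + m) * e
    collect = solve-∀

  reverseRankSum : ℕ → ℕ
  reverseRankSum n = ∑[ k < suc n ] ((n ∸ toℕ k + 1) * lfpCount (suc n) k)

  -- R_n + S_{n+1} = (n+2) T_{n+1}, since (n - k + 1) + (k + 1) = n + 2.
  reverseRankSum-complement : (n : ℕ) → reverseRankSum n + rankSum (suc n) ≡ suc (suc n) * lfpTotal (suc n)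
  reverseRankSum-complement n = begin
    ∑[ k < suc n ] ((n ∸ toℕ k + 1) * Q′ k) + ∑[ k < suc n ] (suc (toℕ k) * Q′ k)
      ≡⟨ ∑-distrib-+ (λ k → (n ∸ toℕ k + 1) * Q′ k) (λ k → suc (toℕ k) * Q′ k) ⟨
    ∑[ k < suc n ] ((n ∸ toℕ k + 1) * Q′ k + suc (toℕ k) * Q′ k)
      ≡⟨ sum-cong-≗ pointwise ⟩
    ∑[ k < suc n ] (suc (suc n) * (1 * Q′ k))
      ≡⟨ *-distribˡ-sum (suc (suc n)) (λ k → 1 * Q′ k) ⟨
    suc (suc n) * lfpTotal (suc n) ∎
    where
    Q′ : Fin (suc n) → ℕ
    Q′ = lfpCount (suc n)
    weights : ∀ k → n ∸ toℕ k + 1 + suc (toℕ k) ≡ suc (suc n)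
    weights k = begin
      n ∸ toℕ k + 1 + suc (toℕ k)   ≡⟨ +-assoc (n ∸ toℕ k) 1 (suc (toℕ k)) ⟩
      n ∸ toℕ k + suc (suc (toℕ k)) ≡⟨ +-suc (n ∸ toℕ k) (suc (toℕ k)) ⟩
      suc (n ∸ toℕ k + suc (toℕ k)) ≡⟨ cong suc (+-suc (n ∸ toℕ k) (toℕ k)) ⟩
      suc (suc (n ∸ toℕ k + toℕ k)) ≡⟨ cong (suc ∘ suc) (m∸n+n≡m (toℕ≤pred[n] k)) ⟩
      suc (suc n)                   ∎
    pointwise : ∀ k → (n ∸ toℕ k + 1) * Q′ k + suc (toℕ k) * Q′ k ≡ suc (suc n) * (1 * Q′ k)
    pointwise k = begin
      (n ∸ toℕ k + 1) * Q′ k + suc (toℕ k) * Q′ k ≡⟨ *-distribʳ-+ (Q′ k) (n ∸ toℕ k + 1) (suc (toℕ k)) ⟨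
      (n ∸ toℕ k + 1 + suc (toℕ k)) * Q′ k        ≡⟨ cong (_* Q′ k) (weights k) ⟩
      suc (suc n) * Q′ k                          ≡⟨ cong (suc (suc n) *_) (*-identityˡ (Q′ k)) ⟨
      suc (suc n) * (1 * Q′ k)                    ∎

  sumFin-cast : (m : ℕ) (f g : Fin m → ℕ) →
                sumFin m (λ k → ℤ.+ f k ℤ.* ℤ.+ g k) ≡ ℤ.+ (∑[ k < m ] (f k * g k))
  sumFin-cast zero    f g = refl
  sumFin-cast (suc m) f g = begin
    ℤ.+ f fzero ℤ.* ℤ.+ g fzero ℤ.+ sumFin m (λ k → ℤ.+ f (fsuc k) ℤ.* ℤ.+ g (fsuc k))
      ≡⟨ cong₂ ℤ._+_ (sym (ℤ.pos-* (f fzero) (g fzero))) (sumFin-cast m (f ∘ fsuc) (g ∘ fsuc)) ⟩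
    ℤ.+ (f fzero * g fzero) ℤ.+ ℤ.+ (∑[ k < m ] (f (fsuc k) * g (fsuc k)))
      ≡⟨ ℤ.pos-+ (f fzero * g fzero) _ ⟨
    ℤ.+ (∑[ k < suc m ] (f k * g k)) ∎

  sumFin-Q : (n : ℕ) (c : Fin (suc n) → ℕ) →
    sumFin (suc n) (λ k → ℤ.+ c k ℤ.* ℤ.+ Q n k) ≡ ℤ.+ (∑[ k < suc n ] (c k * lfpCount (suc n) k))
  sumFin-Q n c = trans (sumFin-cast (suc n) c (Q n))
                       (cong ℤ.+_ (sum-cong-≗ (λ k → cong (c k *_) (Q≡lfpCount n k))))

  rankSum-as-sumFin : (n : ℕ) → sumFin (suc n) (λ k → ℤ.+ (toℕ k + 1) ℤ.* ℤ.+ Q n k) ≡ ℤ.+ rankSum (suc n)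
  rankSum-as-sumFin n = trans (sumFin-Q n (λ k → toℕ k + 1))
    (cong ℤ.+_ (sum-cong-≗ (λ k → cong (_* lfpCount (suc n) k) (+-comm (toℕ k) 1))))

  reverseRankSum-as-sumFin : (n : ℕ) →
    sumFin (suc n) (λ k → ℤ.+ (n ∸ toℕ k + 1) ℤ.* ℤ.+ Q n k) ≡ ℤ.+ reverseRankSum n
  reverseRankSum-as-sumFin n = sumFin-Q n (λ k → n ∸ toℕ k + 1)

open import Defs
open import Data.Nat using (ℕ; suc; _∸_)
open import Data.Nat.Properties using (+-comm)
open import Data.Fin using (toℕ)
open import Data.Integer using (ℤ; +_; _+_; _-_; _*_)
open import Data.Integer.Properties using (pos-+; pos-*)
open import Data.Integer.Tactic.RingSolver using (solve-∀)
open import Data.Product using (_×_; _,_)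
open import Relation.Binary.PropositionalEquality using (_≡_; refl; trans; cong; cong₂; module ≡-Reasoning)
open Counting
  using (rankSum; reverseRankSum; lfpTotal; rankSum-closed; lfpTotal-closed; reverseRankSum-complement;
         rankSum-as-sumFin; reverseRankSum-as-sumFin)
import Data.Nat as ℕ

open ≡-Reasoning

difference : {a b c : ℕ} → a ℕ.+ b ≡ c → + a ≡ + c - + b
difference {a} {b} refl = begin
  + a               ≡⟨ add-sub (+ a) (+ b) ⟩
  + a + + b - + b   ≡⟨ cong (_- + b) (pos-+ a b) ⟨
  + (a ℕ.+ b) - + b ∎
  where
  add-sub : ∀ x y → x ≡ x + y - y
  add-sub = solve-∀

pos-+* : (a b c : ℕ) → + (a ℕ.+ b ℕ.* c) ≡ + a + + b * + c
pos-+* a b c = trans (pos-+ a (b ℕ.* c)) (cong (λ x → + a + x) (pos-* b c))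

first-sum : {S I₁ I₂ M₂ k : ℕ} → S ℕ.+ I₂ ≡ M₂ ℕ.+ k ℕ.* I₁ → + S ≡ + M₂ - + I₂ + + k * + I₁
first-sum {S} {I₁} {I₂} {M₂} {k} eq = begin
  + S                        ≡⟨ difference eq ⟩
  + (M₂ ℕ.+ k ℕ.* I₁) - + I₂ ≡⟨ cong (_- + I₂) (pos-+* M₂ k I₁) ⟩
  + M₂ + + k * + I₁ - + I₂   ≡⟨ reorder (+ M₂) (+ k) (+ I₁) (+ I₂) ⟩
  + M₂ - + I₂ + + k * + I₁   ∎
  where
  reorder : ∀ a b c d → a + b * c - d ≡ a - d + b * c
  reorder = solve-∀

second-sum : {R S T I₁ M₁ I₂ M₂ k : ℕ} →
             R ℕ.+ S ≡ k ℕ.* T → T ℕ.+ M₁ ≡ I₁ → S ℕ.+ I₂ ≡ M₂ ℕ.+ k ℕ.* I₁ →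
             + R ≡ + I₂ - + k * + M₁ - + M₂
second-sum {R} {S} {T} {I₁} {M₁} {I₂} {M₂} {k} eqR eqT eqS = begin
  + R                                          ≡⟨ difference eqR ⟩
  + (k ℕ.* T) - + S                            ≡⟨ cong (_- + S) (pos-* k T) ⟩
  + k * + T - + S                              ≡⟨ cong₂ (λ t s → + k * t - s) (difference eqT)
                                                        (trans (difference eqS) (cong (_- + I₂) (pos-+* M₂ k I₁))) ⟩
  + k * (+ I₁ - + M₁) - (+ M₂ + + k * + I₁ - + I₂) ≡⟨ simplify (+ k) (+ I₁) (+ M₁) (+ M₂) (+ I₂) ⟩
  + I₂ - + k * + M₁ - + M₂                     ∎
  where
  simplify : ∀ k i₁ m₁ m₂ i₂ → k * (i₁ - m₁) - (m₂ + k * i₁ - i₂) ≡ i₂ - k * m₁ - m₂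
  simplify = solve-∀

rankSum-closedℤ : (n S : ℕ) → S ℕ.+ I (suc (suc n)) ≡ M (suc (suc n)) ℕ.+ suc (suc n) ℕ.* I (suc n) →
                  + S ≡ + M (n ℕ.+ 2) - + I (n ℕ.+ 2) + + (n ℕ.+ 2) * + I (n ℕ.+ 1)
rankSum-closedℤ n S eq rewrite +-comm n 2 | +-comm n 1 =
  first-sum {I₁ = I (suc n)} {I₂ = I (suc (suc n))} {M₂ = M (suc (suc n))} {k = suc (suc n)} eq

reverseRankSum-closedℤ : (n R S T : ℕ) → R ℕ.+ S ≡ suc (suc n) ℕ.* T → T ℕ.+ M (suc n) ≡ I (suc n) →
                         S ℕ.+ I (suc (suc n)) ≡ M (suc (suc n)) ℕ.+ suc (suc n) ℕ.* I (suc n) →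
                         + R ≡ + I (n ℕ.+ 2) - + (n ℕ.+ 2) * + M (n ℕ.+ 1) - + M (n ℕ.+ 2)
reverseRankSum-closedℤ n R S T eqR eqT eqS rewrite +-comm n 2 | +-comm n 1 =
  second-sum {S = S} {T = T} {I₁ = I (suc n)} {M₁ = M (suc n)} {I₂ = I (suc (suc n))} {M₂ = M (suc (suc n))}
             {k = suc (suc n)} eqR eqT eqS

theorem4p5 : (n : ℕ) →
    (sumFin (suc n) (λ k → + (toℕ k Data.Nat.+ 1) * + Q n k)
      ≡ + M (n Data.Nat.+ 2) - + I (n Data.Nat.+ 2) + + (n Data.Nat.+ 2) * + I (n Data.Nat.+ 1))
    × (sumFin (suc n) (λ k → + (n ∸ toℕ k Data.Nat.+ 1) * + Q n k)
      ≡ + I (n Data.Nat.+ 2) - + (n Data.Nat.+ 2) * + M (n Data.Nat.+ 1) - + M (n Data.Nat.+ 2))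
theorem4p5 n =
    trans (rankSum-as-sumFin n) (rankSum-closedℤ n _ (rankSum-closed (suc n)))
  , trans (reverseRankSum-as-sumFin n)
          (reverseRankSum-closedℤ n (reverseRankSum n) (rankSum (suc n)) (lfpTotal (suc n))
             (reverseRankSum-complement n) (lfpTotal-closed (suc n)) (rankSum-closed (suc n)))
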